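{- Let $G$ be a graph with a $\Delta$-disk representation $\{D_v=D((x_v,y_v),r_v)\}_{v\in V(G)}$ and let $v\in V(G)$. If for some real $t\leq\min(x_v,y_v)$ the set $D_v\cap[0,t]^2$ is non-empty, then $(t,t)\in D_v$.
   Context: A $\Delta$-disk representation of $G$ is a family of closed disks $D_v$ with center $(x_v,y_v)$ and radius $r_v$, for $v\in V(G)$, such that $uv\in E(G)$ iff $D_u\cap D_v\neq\emptyset$, and for every $v$: $x_v>0$, $y_v>0$ and $\max(x_v,y_v)\leq r_v<\sqrt{x_v^2+y_v^2}$. -}

module Defs where

open import Level using (Level; _⊔_) renaming (suc to lsuc)
open import Algebra.Bundles using (CommutativeRing)
open import Relation.Binary.Structures using (IsTotalOrder)
open import Relation.Nullary using (¬_)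
open import Data.Product using (Σ; ∃; _×_)
open import Data.Nat using (ℕ)
open import Data.Fin using (Fin)
open import Relation.Binary.PropositionalEquality using (_≡_)
open import Function.Bundles using (_⇔_)

-- An ordered field (ℝ is one).  Stdlib has no reals, so results are
-- stated for an arbitrary ordered field.
record OrderedField (c ℓ₁ ℓ₂ : Level) : Set (lsuc (c ⊔ ℓ₁ ⊔ ℓ₂)) where
  field
    commutativeRing : CommutativeRing c ℓ₁
  open CommutativeRing commutativeRing public
  field
    _≤_          : Carrier → Carrier → Set ℓ₂
    isTotalOrder : IsTotalOrder _≈_ _≤_
    0≉1          : ¬ (0# ≈ 1#)
    inverse      : ∀ x → ¬ (x ≈ 0#) → Σ Carrier (λ y → (x * y) ≈ 1#)
    +-mono-≤     : ∀ {x y} z → x ≤ y → (x + z) ≤ (y + z)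
    *-nonneg     : ∀ {x y} → 0# ≤ x → 0# ≤ y → 0# ≤ (x * y)

  _<_ : Carrier → Carrier → Set (ℓ₁ ⊔ ℓ₂)
  x < y = (x ≤ y) × ¬ (x ≈ y)

  sq : Carrier → Carrier
  sq x = x * x

module _ {c ℓ₁ ℓ₂} (F : OrderedField c ℓ₁ ℓ₂) where
  open OrderedField F

  InDisk : (x y r a b : Carrier) → Set ℓ₂
  InDisk x y r a b = (sq (a - x) + sq (b - y)) ≤ sq r

  record SimpleGraph (n : ℕ) : Set (lsuc ℓ₂) where
    field
      Adj     : Fin n → Fin n → Set ℓ₂
      sym     : ∀ {u v} → Adj u v → Adj v u
      irrefl  : ∀ {u} → ¬ Adj u u

  -- Δ-disk representation of G: centers (xs v , ys v), radii rs v.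
  -- r < √(x²+y²) is written r² < x²+y² (equivalent since r ≥ x > 0).
  record ΔDiskRep {n : ℕ} (G : SimpleGraph n) : Set (c ⊔ ℓ₁ ⊔ ℓ₂) where
    open SimpleGraph G
    field
      xs ys rs : Fin n → Carrier
      x-pos    : ∀ v → 0# < xs v
      y-pos    : ∀ v → 0# < ys v
      x≤r      : ∀ v → xs v ≤ rs v
      y≤r      : ∀ v → ys v ≤ rs v
      r<norm   : ∀ v → sq (rs v) < (sq (xs v) + sq (ys v))
      edges    : ∀ u v → ¬ (u ≡ v) →
                 (Adj u v ⇔ Σ Carrier (λ a → Σ Carrier (λ b →
                    InDisk (xs u) (ys u) (rs u) a b × InDisk (xs v) (ys v) (rs v) a b)))

-- Each term of the squared distance (a − x)² + (b − y)² to the centre (x , y)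
-- only shrinks as a moves up towards x and b moves up towards y.  A point
-- (a , b) of D_v in [0 , t]² with t ≤ min(x_v , y_v) therefore lies no closer
-- to the centre than (t , t), so (t , t) ∈ D_v as well.
module Submission where

open import Defs
open import Level using (Level)
open import Data.Nat using (ℕ)
open import Data.Fin using (Fin)
open import Data.Product using (Σ; _×_; _,_)
open import Relation.Binary.Bundles using (Poset)
open import Relation.Binary.Structures using (IsTotalOrder)
import Algebra.Properties.Ring as RingProperties
import Algebra.Properties.AbelianGroup as AbelianGroupProperties
import Algebra.Properties.Group as GroupProperties
import Relation.Binary.Reasoning.PartialOrder as ≤-Reasoning
import Relation.Binary.Reasoning.Setoid as ≈-Reasoning

module OrderedFieldProperties {c ℓ₁ ℓ₂} (F : OrderedField c ℓ₁ ℓ₂) where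
  open OrderedField F renaming (_≤_ to infix 4 _≤_)
  open RingProperties ring using (-‿distribˡ-*; -‿distribʳ-*; x[y-z]≈xy-xz)
  open AbelianGroupProperties +-abelianGroup using (⁻¹-anti-homo‿-)
  open GroupProperties +-group using (⁻¹-involutive; //-rightDividesˡ)
  open IsTotalOrder isTotalOrder using (isPartialOrder; ≤-respˡ-≈; ≤-respʳ-≈)
    renaming (trans to ≤-trans)

  poset : Poset c ℓ₁ ℓ₂
  poset = record { isPartialOrder = isPartialOrder }

  ≤⇒0≤- : ∀ {u w} → u ≤ w → 0# ≤ w - u
  ≤⇒0≤- {u} {w} u≤w = ≤-respˡ-≈ (-‿inverseʳ u) (+-mono-≤ (- u) u≤w)

  0≤-⇒≤ : ∀ {u w} → 0# ≤ w - u → u ≤ w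
  0≤-⇒≤ {u} {w} 0≤w-u = begin
    u             ≈⟨ +-identityˡ u ⟨
    0# + u        ≤⟨ +-mono-≤ u 0≤w-u ⟩
    (w - u) + u   ≈⟨ //-rightDividesˡ u w ⟩
    w             ∎
    where open ≤-Reasoning poset

  *-monoˡ-≤-nonNeg : ∀ {z p q} → 0# ≤ z → p ≤ q → z * p ≤ z * q
  *-monoˡ-≤-nonNeg {z} {p} {q} 0≤z p≤q =
    0≤-⇒≤ (≤-respʳ-≈ (x[y-z]≈xy-xz z q p) (*-nonneg 0≤z (≤⇒0≤- p≤q)))

  sq-mono-≤-nonNeg : ∀ {u w} → 0# ≤ u → u ≤ w → sq u ≤ sq w
  sq-mono-≤-nonNeg {u} {w} 0≤u u≤w = begin
    u * u   ≤⟨ *-monoˡ-≤-nonNeg 0≤u u≤w ⟩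
    u * w   ≈⟨ *-comm u w ⟩
    w * u   ≤⟨ *-monoˡ-≤-nonNeg (≤-trans 0≤u u≤w) u≤w ⟩
    w * w   ∎
    where open ≤-Reasoning poset

  -‿antimono-≤ : ∀ {a b} → a ≤ b → - b ≤ - a
  -‿antimono-≤ {a} {b} a≤b = 0≤-⇒≤ (≤-respʳ-≈ b-a≈-a--b (≤⇒0≤- a≤b))
    where
    open ≈-Reasoning setoid
    b-a≈-a--b : b - a ≈ - a - - b
    b-a≈-a--b = begin
      b - a       ≈⟨ +-comm b (- a) ⟩
      - a + b     ≈⟨ +-congˡ (⁻¹-involutive b) ⟨
      - a - - b   ∎

  -‿antimonoʳ-≤ : ∀ {a b} x → a ≤ b → x - b ≤ x - a
  -‿antimonoʳ-≤ {a} {b} x a≤b = begin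
    x - b   ≈⟨ +-comm x (- b) ⟩
    - b + x ≤⟨ +-mono-≤ x (-‿antimono-≤ a≤b) ⟩
    - a + x ≈⟨ +-comm (- a) x ⟩
    x - a   ∎
    where open ≤-Reasoning poset

  +-mono-≤-both : ∀ {p q p′ q′} → p ≤ q → p′ ≤ q′ → p + p′ ≤ q + q′
  +-mono-≤-both {p} {q} {p′} {q′} p≤q p′≤q′ = begin
    p + p′  ≤⟨ +-mono-≤ p′ p≤q ⟩
    q + p′  ≈⟨ +-comm q p′ ⟩
    p′ + q  ≤⟨ +-mono-≤ q p′≤q′ ⟩
    q′ + q  ≈⟨ +-comm q′ q ⟩
    q + q′  ∎
    where open ≤-Reasoning poset

  sq-neg : ∀ u → sq (- u) ≈ sq u
  sq-neg u = begin
    - u * - u       ≈⟨ -‿distribˡ-* u (- u) ⟨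
    - (u * - u)     ≈⟨ -‿cong (-‿distribʳ-* u u) ⟨
    - - (u * u)     ≈⟨ ⁻¹-involutive (u * u) ⟩
    u * u           ∎
    where open ≈-Reasoning setoid

  sq-sub-comm : ∀ a x → sq (a - x) ≈ sq (x - a)
  sq-sub-comm a x = trans (*-cong a-x≈-[x-a] a-x≈-[x-a]) (sq-neg (x - a))
    where
    a-x≈-[x-a] : a - x ≈ - (x - a)
    a-x≈-[x-a] = sym (⁻¹-anti-homo‿- x a)

  sq-sub-antimono-≤ : ∀ {a a′ x} → a ≤ a′ → a′ ≤ x → sq (a′ - x) ≤ sq (a - x)
  sq-sub-antimono-≤ {a} {a′} {x} a≤a′ a′≤x = begin
    sq (a′ - x)   ≈⟨ sq-sub-comm a′ x ⟩
    sq (x - a′)   ≤⟨ sq-mono-≤-nonNeg (≤⇒0≤- a′≤x) (-‿antimonoʳ-≤ x a≤a′) ⟩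
    sq (x - a)    ≈⟨ sq-sub-comm a x ⟨
    sq (a - x)    ∎
    where open ≤-Reasoning poset

  InDisk-towardsCentre : ∀ {x y r a b a′ b′} →
                         a ≤ a′ → a′ ≤ x → b ≤ b′ → b′ ≤ y →
                         InDisk F x y r a b → InDisk F x y r a′ b′
  InDisk-towardsCentre a≤a′ a′≤x b≤b′ b′≤y ab∈D = ≤-trans
    (+-mono-≤-both (sq-sub-antimono-≤ a≤a′ a′≤x) (sq-sub-antimono-≤ b≤b′ b′≤y))
    ab∈D

lemma22 : ∀ {c ℓ₁ ℓ₂ : Level} (F : OrderedField c ℓ₁ ℓ₂) {n : ℕ}
            (G : SimpleGraph F n) (R : ΔDiskRep F G) (v : Fin n)
            (t : OrderedField.Carrier F) →
            OrderedField._≤_ F t (ΔDiskRep.xs R v) →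
            OrderedField._≤_ F t (ΔDiskRep.ys R v) →
            Σ (OrderedField.Carrier F) (λ a → Σ (OrderedField.Carrier F) (λ b →
               (OrderedField._≤_ F (OrderedField.0# F) a × OrderedField._≤_ F a t) ×
               (OrderedField._≤_ F (OrderedField.0# F) b × OrderedField._≤_ F b t) ×
               InDisk F (ΔDiskRep.xs R v) (ΔDiskRep.ys R v) (ΔDiskRep.rs R v) a b)) →
            InDisk F (ΔDiskRep.xs R v) (ΔDiskRep.ys R v) (ΔDiskRep.rs R v) t t
lemma22 F G R v t t≤x t≤y (a , b , (_ , a≤t) , (_ , b≤t) , ab∈D) =
  OrderedFieldProperties.InDisk-towardsCentre F a≤t t≤x b≤t t≤y ab∈D
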